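{- Let $G$ be an abelian group and let $A\subseteq G$ be a finite subset with $|A|\geqslant 3$. Then $|2\wedge A|<|A|$ if and only if $A$ is a $2$-coset.
   Context: $2\wedge A:=\{x+y: x,y\in A,\ x\neq y\}$. An elementary $2$-subgroup of $G$ is a finite subgroup in which every non-identity element has order $2$. A $2$-coset is a coset of an elementary $2$-subgroup of $G$. -}

module Defs where

open import Level using (Level; _⊔_)
open import Algebra.Bundles using (AbelianGroup)
open import Data.List using (List; length)
open import Data.Nat using (ℕ; _≤_)
open import Data.Product using (Σ; ∃; _×_; Σ-syntax; ∃-syntax)
open import Relation.Nullary using (¬_)
import Data.List.Membership.Setoid as Mem
import Data.List.Relation.Unary.Unique.Setoid as Uniq

module _ {c ℓ : Level} (G : AbelianGroup c ℓ) where
  open AbelianGroup G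
  open Mem setoid using (_∈_)

  -- A finite subset of G, given as a duplicate-free list (w.r.t. ≈);
  -- its cardinality is the length of the list.
  IsFinSubset : List Carrier → Set (c ⊔ ℓ)
  IsFinSubset A = Uniq.Unique setoid A

  Wedge2 : List Carrier → Carrier → Set (c ⊔ ℓ)
  Wedge2 A z = ∃[ x ] ∃[ y ] (x ∈ A × y ∈ A × ¬ (x ≈ y) × z ≈ x ∙ y)

  -- |P| ≤ k : the subset P of G is covered by a list of at most k elements.
  CardLe : (Carrier → Set (c ⊔ ℓ)) → ℕ → Set (c ⊔ ℓ)
  CardLe P k = Σ[ L ∈ List Carrier ] (length L ≤ k × (∀ z → P z → z ∈ L))

  record IsElem2Subgroup (H : List Carrier) : Set (c ⊔ ℓ) where
    field
      unique   : Uniq.Unique setoid H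
      has-ε    : ε ∈ H
      ∙-closed : ∀ {x y} → x ∈ H → y ∈ H → (x ∙ y) ∈ H
      ⁻¹-closed : ∀ {x} → x ∈ H → (x ⁻¹) ∈ H
      order-2  : ∀ {x} → x ∈ H → ¬ (x ≈ ε) → (x ∙ x) ≈ ε

  Is2Coset : List Carrier → Set (c ⊔ ℓ)
  Is2Coset A = ∃[ H ] ∃[ g ] (IsElem2Subgroup H ×
                 (∀ x → (x ∈ A → ∃[ h ] (h ∈ H × x ≈ g ∙ h))
                      × (∃[ h ] (h ∈ H × x ≈ g ∙ h) → x ∈ A)))

module Submission where

open import Defs
open import Level using (Level)
open import Algebra.Bundles using (AbelianGroup)
open import Data.List using (List; length)
open import Data.Nat using (_≤_; _<_)
open import Data.Product using (_×_; ∃-syntax)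
open import Function.Bundles using (_⇔_)

-- Call a finite
-- A ⊆ G 2-affine if it is closed under (x, y, z) ↦ x + y − z and x + x is
-- the same for all x ∈ A.
--
--   * |2∧A| < |A|  ⇒  A is 2-affine  (the combinatorial heart).  For every
--     c ∈ A the |A| − 1 distinct sums c + a (a ≠ c) lie in 2∧A, so by
--     pigeonhole every element of 2∧A is such a sum.  Hence a + b − c ∈ A for
--     a ≠ b, 2a ∉ 2∧A, and a short argument with a third element gives
--     2a − c ∈ A and then 2a = 2c.
--   * A 2-affine  ⇒  A is a 2-coset: A = x₀ + (A − x₀), and A − x₀ is an
--     elementary 2-subgroup.
--   * A 2-coset  ⇒  A is 2-affine, by computing in g + H.
--   * A 2-affine  ⇒  2∧A ⊆ a₀ + (A ∖ {a₀}), which has |A| − 1 elements.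

open import Data.List using ([]; _∷_; map; lookup)
open import Data.List.Properties using (length-map)
open import Data.Nat using (suc; s≤s; _+_)
open import Data.Nat.Properties using (≤-<-trans; ≤-pred; n<1+n; ≤-reflexive)
open import Data.Fin as Fin using (Fin; punchIn) renaming (zero to fz; suc to fs)
open import Data.Fin.Properties using (_≟_; pigeonhole; <⇒≢; punchIn-injective; punchInᵢ≢i)
open import Data.Product using (_,_; proj₁; proj₂; ∃₂)
open import Data.Empty using (⊥-elim)
open import Function using (_∘_; mk⇔)
open import Relation.Nullary using (¬_; Dec; yes; no)
open import Relation.Binary.Bundles using (Setoid)
open import Relation.Binary.PropositionalEquality using (_≡_; _≢_; refl; cong) renaming (sym to ≡-sym)
open import Data.List.Relation.Unary.AllPairs using (_∷_)
open import Data.List.Relation.Unary.Any using (here; there; index)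
open import Data.List.Relation.Unary.Any.Properties using (lookup-index)
import Data.List.Relation.Unary.All as All
import Data.List.Membership.Propositional.Properties as MemPropP
import Data.List.Membership.Setoid as Mem
import Data.List.Membership.Setoid.Properties as MemP
import Data.List.Relation.Unary.Unique.Setoid as Uniq
import Data.List.Relation.Unary.Unique.Setoid.Properties as UniqP
import Algebra.Properties.AbelianGroup as AbelianGroupProperties
import Algebra.Solver.CommutativeMonoid as CMSolver

besides-zero : ∀ {m} (x : Fin (3 + m)) → ∃[ b ] (b ≢ x × b ≢ fz)
besides-zero x with fs fz ≟ x
... | no 1≢x    = fs fz , 1≢x , λ ()
... | yes refl  = fs (fs fz) , (λ ()) , (λ ())

avoid-two : ∀ {m} (a c : Fin (3 + m)) → ∃[ b ] (b ≢ a × b ≢ c)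
avoid-two a c with fz ≟ a | fz ≟ c
... | no 0≢a   | no 0≢c   = fz , 0≢a , 0≢c
... | yes refl | _        = let (b , b≢c , b≢0) = besides-zero c in b , b≢0 , b≢c
... | no _     | yes refl = besides-zero a

module DuplicateFreeLists {a ℓ} (S : Setoid a ℓ) where
  open Setoid S using (Carrier; _≈_; sym; trans; reflexive)
  open Mem S using (_∈_)
  open Uniq S using (Unique)

  same-position : ∀ {xs x y} (p : x ∈ xs) (q : y ∈ xs) → index p ≡ index q → x ≈ y
  same-position {xs} p q e =
    trans (lookup-index p) (trans (reflexive (cong (lookup xs) e)) (sym (lookup-index q)))

  lookup-injective : ∀ {xs} → Unique xs → ∀ {i j} → lookup xs i ≈ lookup xs j → i ≡ j
  lookup-injective (_  ∷ _) {fz}   {fz}   _ = refl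
  lookup-injective (x≉ ∷ _) {fz}   {fs j} e = ⊥-elim (All.lookup x≉ (MemPropP.∈-lookup j) e)
  lookup-injective (x≉ ∷ _) {fs i} {fz}   e = ⊥-elim (All.lookup x≉ (MemPropP.∈-lookup i) (sym e))
  lookup-injective (_  ∷ u) {fs i} {fs j} e = cong fs (lookup-injective u e)

  -- Equality is decidable between members of a duplicate-free list (compare
  -- their positions), although it need not be decidable on the whole setoid.
  ∈-≈-dec : ∀ {xs x y} → Unique xs → x ∈ xs → y ∈ xs → Dec (x ≈ y)
  ∈-≈-dec u p q with index p ≟ index q
  ... | yes e = yes (same-position p q e)
  ... | no ne = no λ x≈y → ne (lookup-injective u (trans (sym (lookup-index p)) (trans x≈y (lookup-index q))))

  saturated : ∀ {k L z} (h : Fin k → Carrier) → (∀ {i j} → h i ≈ h j → i ≡ j) →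
              (∀ j → h j ∈ L) → length L ≤ k → z ∈ L → ∃[ j ] (z ≈ h j)
  saturated {k} {L} {z} h h-inj h∈L |L|≤k z∈L = collision (pigeonhole (s≤s |L|≤k) position)
    where
    position : Fin (suc k) → Fin (length L)
    position fz     = index z∈L
    position (fs j) = index (h∈L j)

    collision : ∃₂ (λ i j → i Fin.< j × position i ≡ position j) → ∃[ j ] (z ≈ h j)
    collision (fz   , fz   , ()  , _)
    collision (fs _ , fz   , ()  , _)
    collision (fz   , fs j , _   , e) = j , same-position z∈L (h∈L j) e
    collision (fs i , fs j , i<j , e) =
      ⊥-elim (<⇒≢ i<j (cong fs (h-inj (same-position (h∈L i) (h∈L j) e))))

module Theory {c ℓ} (G : AbelianGroup c ℓ) where
  open AbelianGroup G renaming (refl to ≈-refl)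
  open AbelianGroupProperties G using (∙-cancelˡ; ∙-cancelʳ; x≈z//y; //-rightDividesˡ;
    //-rightDividesʳ; //-cong₂; ⁻¹-∙-comm; ⁻¹-anti-homo-//)
  open import Relation.Binary.Reasoning.Setoid setoid
  open CMSolver commutativeMonoid using (solve; _⊜_; _⊕_)
  open Mem setoid using (_∈_)
  open MemP using (∈-lookup; ∈-resp-≈; ∈-map⁺; ∈-map⁻)
  open DuplicateFreeLists setoid

  unshift : ∀ {x y z} → x ≈ y - z → x ∙ z ≈ y
  unshift {x} {y} {z} e = trans (∙-congʳ e) (//-rightDividesˡ z y)

  translate-back : ∀ x y → y ∙ (x - y) ≈ x
  translate-back x y = trans (comm y (x - y)) (//-rightDividesˡ y x)

  -- (a − g) + (b − g) = (a + b − g) − g: the translate A − g is closed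
  -- under + once A is closed under x + y − g.
  diff-pair : ∀ a b g → (a - g) ∙ (b - g) ≈ a ∙ b - g - g
  diff-pair a b g =
    solve 3 (λ a b g⁻ → (a ⊕ g⁻) ⊕ (b ⊕ g⁻) ⊜ ((a ⊕ b) ⊕ g⁻) ⊕ g⁻) ≈-refl a b (g ⁻¹)

  diff-insert : ∀ x y z → x - y ≈ x ∙ z - y - z
  diff-insert x y z = sym (begin
    x ∙ z - y - z    ≈⟨ ∙-congʳ (solve 3 (λ x z y⁻ → (x ⊕ z) ⊕ y⁻ ⊜ (x ⊕ y⁻) ⊕ z) ≈-refl x z (y ⁻¹)) ⟩
    (x - y) ∙ z - z  ≈⟨ //-rightDividesʳ z (x - y) ⟩
    x - y            ∎)

  substitute-diff : ∀ {a b c d} → d ≈ a ∙ b - c → a ∙ d - b ≈ a ∙ a - c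
  substitute-diff {a} {b} {c} {d} e = begin
    a ∙ d - b            ≈⟨ ∙-congʳ (∙-congˡ e) ⟩
    a ∙ (a ∙ b - c) - b  ≈⟨ ∙-congʳ (solve 3 (λ a b c⁻ → a ⊕ ((a ⊕ b) ⊕ c⁻) ⊜ ((a ⊕ a) ⊕ c⁻) ⊕ b)
                                             ≈-refl a b (c ⁻¹)) ⟩
    (a ∙ a - c) ∙ b - b  ≈⟨ //-rightDividesʳ b (a ∙ a - c) ⟩
    a ∙ a - c            ∎

  translate-affine : ∀ g h₁ h₂ h₃ → (g ∙ h₁) ∙ (g ∙ h₂) - (g ∙ h₃) ≈ g ∙ (h₁ ∙ h₂ - h₃)
  translate-affine g h₁ h₂ h₃ = begin
    (g ∙ h₁) ∙ (g ∙ h₂) - (g ∙ h₃)       ≈⟨ ∙-congˡ (sym (⁻¹-∙-comm g h₃)) ⟩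
    (g ∙ h₁) ∙ (g ∙ h₂) ∙ (g ⁻¹ ∙ h₃ ⁻¹)  ≈⟨ solve 5 (λ g h₁ h₂ g⁻ h₃⁻ →
                                               ((g ⊕ h₁) ⊕ (g ⊕ h₂)) ⊕ (g⁻ ⊕ h₃⁻)
                                             ⊜ ((g ⊕ ((h₁ ⊕ h₂) ⊕ h₃⁻)) ⊕ g) ⊕ g⁻)
                                             ≈-refl g h₁ h₂ (g ⁻¹) (h₃ ⁻¹) ⟩
    (g ∙ (h₁ ∙ h₂ - h₃)) ∙ g - g         ≈⟨ //-rightDividesʳ g _ ⟩
    g ∙ (h₁ ∙ h₂ - h₃)                   ∎

  translate-double : ∀ {h} g → h ∙ h ≈ ε → (g ∙ h) ∙ (g ∙ h) ≈ g ∙ g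
  translate-double {h} g hh≈ε = begin
    (g ∙ h) ∙ (g ∙ h)  ≈⟨ solve 2 (λ g h → (g ⊕ h) ⊕ (g ⊕ h) ⊜ (g ⊕ g) ⊕ (h ⊕ h)) ≈-refl g h ⟩
    (g ∙ g) ∙ (h ∙ h)  ≈⟨ ∙-congˡ hh≈ε ⟩
    (g ∙ g) ∙ ε        ≈⟨ identityʳ _ ⟩
    g ∙ g              ∎

  square-ε : ∀ {H h} → IsElem2Subgroup G H → h ∈ H → h ∙ h ≈ ε
  square-ε {H} {h} isH h∈H with ∈-≈-dec unique h∈H has-ε
    where open IsElem2Subgroup isH
  ... | yes h≈ε = trans (∙-cong h≈ε h≈ε) (identityʳ ε)
  ... | no h≉ε = IsElem2Subgroup.order-2 isH h∈H h≉ε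

  record Is2Affine (A : List Carrier) : Set (c Level.⊔ ℓ) where
    field
      affine  : ∀ {x y z} → x ∈ A → y ∈ A → z ∈ A → x ∙ y - z ∈ A
      doubles : ∀ {x y} → x ∈ A → y ∈ A → x ∙ x ≈ y ∙ y

  -- The combinatorial core, for A = {f i} with |A| = 3 + m and 2∧A covered by
  -- a list L with |L| ≤ |A| − 1.
  module SmallWedge {m} (f : Fin (3 + m) → Carrier) (f-inj : ∀ {i j} → f i ≈ f j → i ≡ j)
                    (L : List Carrier) (|L|≤ : length L ≤ 2 + m)
                    (sum∈L : ∀ {i j} → i ≢ j → f i ∙ f j ∈ L) where

    -- The translate f c + (A ∖ {f c}) has |A| − 1 distinct members, all in L,
    -- so it exhausts L.
    L⊆translate : ∀ c {z} → z ∈ L → ∃[ x ] (x ≢ c × z ≈ f c ∙ f x)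
    L⊆translate c z∈L =
      let (j , z≈) = saturated (λ j → f c ∙ f (punchIn c j)) shifted-inj
                       (λ j → sum∈L (λ c≡ → punchInᵢ≢i c j (≡-sym c≡))) |L|≤ z∈L
      in punchIn c j , punchInᵢ≢i c j , z≈
      where
      shifted-inj : ∀ {i j} → f c ∙ f (punchIn c i) ≈ f c ∙ f (punchIn c j) → i ≡ j
      shifted-inj e = punchIn-injective c _ _ (f-inj (∙-cancelˡ (f c) _ _ e))

    shift-distinct : ∀ {a b} c → a ≢ b → ∃[ x ] (f x ≈ f a ∙ f b - f c)
    shift-distinct {a} {b} c a≢b =
      let (x , _ , e) = L⊆translate c (sum∈L a≢b)
      in x , x≈z//y (f x) (f c) _ (trans (comm (f x) (f c)) (sym e))

    -- A double a + a is not in L: it would equal a + x with x ≠ a.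
    double∉L : ∀ a → ¬ (f a ∙ f a ∈ L)
    double∉L a aa∈L =
      let (x , x≢a , e) = L⊆translate a aa∈L
      in x≢a (f-inj (sym (∙-cancelˡ (f a) _ _ e)))

    -- 2a − c ∈ A: pick b ∉ {a, c}; d = a + b − c ∈ A differs from a, so
    -- a + d − b = 2a − c ∈ A.
    shift-double : ∀ a c → ∃[ d ] (f d ≈ f a ∙ f a - f c)
    shift-double a c with a ≟ c
    ... | yes refl = a , sym (//-rightDividesʳ (f a) (f a))
    ... | no _ with avoid-two a c
    ... | b , b≢a , b≢c with shift-distinct c (b≢a ∘ ≡-sym)
    ... | d , d≈ with d ≟ a
    ... | yes refl = ⊥-elim (b≢c (f-inj (sym (∙-cancelˡ (f a) _ _ (unshift d≈)))))
    ... | no d≢a  = let (y , y≈) = shift-distinct b (d≢a ∘ ≡-sym)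
                    in y , trans y≈ (substitute-diff d≈)

    affine-idx : ∀ a b c → ∃[ d ] (f d ≈ f a ∙ f b - f c)
    affine-idx a b c with a ≟ b
    ... | no a≢b   = shift-distinct c a≢b
    ... | yes refl = shift-double a c

    -- 2a = 2c: with d = 2a − c, either d = c, or c + d = 2a would lie in L.
    doubles-idx : ∀ a c → f a ∙ f a ≈ f c ∙ f c
    doubles-idx a c with shift-double a c
    ... | d , d≈ with d ≟ c
    ... | yes refl = sym (unshift d≈)
    ... | no d≢c  = ⊥-elim (double∉L a (∈-resp-≈ setoid (trans (comm (f c) (f d)) (unshift d≈))
                                                   (sum∈L (d≢c ∘ ≡-sym))))

  small-wedge⇒2affine : ∀ A → IsFinSubset G A → 3 ≤ length A →
    ∃[ k ] (k < length A × CardLe G (Wedge2 G A) k) → Is2Affine A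
  small-wedge⇒2affine []           _ ()             _
  small-wedge⇒2affine (_ ∷ [])     _ (s≤s ())       _
  small-wedge⇒2affine (_ ∷ _ ∷ []) _ (s≤s (s≤s ())) _
  small-wedge⇒2affine A@(_ ∷ _ ∷ _ ∷ _) u _ (k , k<|A| , L , |L|≤k , cover) =
    record { affine = affine ; doubles = doubles }
    where
    f = lookup A
    f-inj : ∀ {i j} → f i ≈ f j → i ≡ j
    f-inj = lookup-injective u
    sum∈L : ∀ {i j} → i ≢ j → f i ∙ f j ∈ L
    sum∈L {i} {j} i≢j =
      cover _ (f i , f j , ∈-lookup setoid A i , ∈-lookup setoid A j , i≢j ∘ f-inj , ≈-refl)
    open SmallWedge f f-inj L (≤-pred (≤-<-trans |L|≤k k<|A|)) sum∈L

    affine : ∀ {x y z} → x ∈ A → y ∈ A → z ∈ A → x ∙ y - z ∈ A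
    affine p q r =
      let (d , d≈) = affine-idx (index p) (index q) (index r)
          xy-z≈fd  = trans (//-cong₂ (∙-cong (lookup-index p) (lookup-index q)) (lookup-index r)) (sym d≈)
      in ∈-resp-≈ setoid (sym xy-z≈fd) (∈-lookup setoid A d)

    doubles : ∀ {x y} → x ∈ A → y ∈ A → x ∙ x ≈ y ∙ y
    doubles p q = trans (∙-cong (lookup-index p) (lookup-index p))
                    (trans (doubles-idx (index p) (index q))
                           (sym (∙-cong (lookup-index q) (lookup-index q))))

  -- A nonempty 2-affine A has 2∧A ⊆ a₀ + (A ∖ {a₀}): x + y = a₀ + w with
  -- w = x + y − a₀ ∈ A, and w = a₀ would give x + y = 2a₀ = 2y, i.e. x = y.
  2affine⇒small-wedge : ∀ {a₀ rest} → Is2Affine (a₀ ∷ rest) →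
    ∃[ k ] (k < length (a₀ ∷ rest) × CardLe G (Wedge2 G (a₀ ∷ rest)) k)
  2affine⇒small-wedge {a₀} {rest} A-aff =
    length rest , n<1+n _ , map (a₀ ∙_) rest , ≤-reflexive (length-map _ rest) , covered
    where
    open Is2Affine A-aff
    a₀∈A = here ≈-refl
    covered : ∀ z → Wedge2 G (a₀ ∷ rest) z → z ∈ map (a₀ ∙_) rest
    covered z (x , y , x∈A , y∈A , x≉y , z≈) with affine x∈A y∈A a₀∈A
    ... | here w≈a₀ =
          ⊥-elim (x≉y (∙-cancelʳ y x y (trans (sym (unshift (sym w≈a₀))) (doubles a₀∈A y∈A))))
    ... | there w∈rest =
          ∈-resp-≈ setoid (sym (trans z≈ (sym (translate-back (x ∙ y) a₀))))
            (∈-map⁺ setoid setoid ∙-congˡ w∈rest)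

  coset⇒2affine : ∀ {A} → Is2Coset G A → Is2Affine A
  coset⇒2affine {A} (H , g , isH , A≡g+H) = record
    { affine  = λ p q r →
        let (h₁ , h₁∈ , x≈) = inH p ; (h₂ , h₂∈ , y≈) = inH q ; (h₃ , h₃∈ , z≈) = inH r
        in proj₂ (A≡g+H _) (h₁ ∙ h₂ - h₃ , ∙-closed (∙-closed h₁∈ h₂∈) (⁻¹-closed h₃∈) ,
             trans (//-cong₂ (∙-cong x≈ y≈) z≈) (translate-affine g h₁ h₂ h₃))
    ; doubles = λ p q →
        let (h₁ , h₁∈ , x≈) = inH p ; (h₂ , h₂∈ , y≈) = inH q
        in trans (∙-cong x≈ x≈) (trans (translate-double g (square-ε isH h₁∈))
                 (sym (trans (∙-cong y≈ y≈) (translate-double g (square-ε isH h₂∈)))))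
    }
    where
    open IsElem2Subgroup isH
    inH : ∀ {x} → x ∈ A → ∃[ h ] (h ∈ H × x ≈ g ∙ h)
    inH {x} = proj₁ (A≡g+H x)

  2affine⇒coset : ∀ {x₀ rest} → IsFinSubset G (x₀ ∷ rest) → Is2Affine (x₀ ∷ rest) →
    Is2Coset G (x₀ ∷ rest)
  2affine⇒coset {x₀} {rest} u A-aff = H , x₀ , H-elementary , A≡x₀+H
    where
    open Is2Affine A-aff
    A = x₀ ∷ rest
    x₀∈A = here ≈-refl
    H = map (_- x₀) A

    fromA : ∀ {a h} → a ∈ A → h ≈ a - x₀ → h ∈ H
    fromA a∈A h≈ = ∈-resp-≈ setoid (sym h≈) (∈-map⁺ setoid setoid ∙-congʳ a∈A)

    origin : ∀ {h} → h ∈ H → ∃[ a ] (a ∈ A × h ≈ a - x₀)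
    origin = ∈-map⁻ setoid setoid

    H-∙-closed : ∀ {h₁ h₂} → h₁ ∈ H → h₂ ∈ H → h₁ ∙ h₂ ∈ H
    H-∙-closed p q =
      let (a , a∈A , h₁≈) = origin p ; (b , b∈A , h₂≈) = origin q
      in fromA (affine a∈A b∈A x₀∈A) (trans (∙-cong h₁≈ h₂≈) (diff-pair a b x₀))

    H-⁻¹-closed : ∀ {h} → h ∈ H → h ⁻¹ ∈ H
    H-⁻¹-closed p =
      let (a , a∈A , h≈) = origin p
      in fromA (affine x₀∈A x₀∈A a∈A)
               (trans (⁻¹-cong h≈) (trans (⁻¹-anti-homo-// a x₀) (diff-insert x₀ a x₀)))

    H-square-ε : ∀ {h} → h ∈ H → h ∙ h ≈ ε
    H-square-ε {h} p =
      let (a , a∈A , h≈) = origin p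
      in begin
        h ∙ h                  ≈⟨ ∙-cong h≈ h≈ ⟩
        (a - x₀) ∙ (a - x₀)    ≈⟨ diff-pair a a x₀ ⟩
        a ∙ a - x₀ - x₀        ≈⟨ ∙-congʳ (∙-congʳ (doubles a∈A x₀∈A)) ⟩
        x₀ ∙ x₀ - x₀ - x₀      ≈⟨ ∙-congʳ (//-rightDividesʳ x₀ x₀) ⟩
        x₀ - x₀                ≈⟨ inverseʳ x₀ ⟩
        ε                      ∎

    H-elementary : IsElem2Subgroup G H
    H-elementary = record
      { unique    = UniqP.map⁺ setoid setoid (∙-cancelʳ (x₀ ⁻¹) _ _) u
      ; has-ε     = fromA x₀∈A (sym (inverseʳ x₀))
      ; ∙-closed  = H-∙-closed
      ; ⁻¹-closed = H-⁻¹-closed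
      ; order-2   = λ p _ → H-square-ε p
      }

    A≡x₀+H : ∀ x → (x ∈ A → ∃[ h ] (h ∈ H × x ≈ x₀ ∙ h)) × (∃[ h ] (h ∈ H × x ≈ x₀ ∙ h) → x ∈ A)
    A≡x₀+H x =
      (λ x∈A → x - x₀ , fromA x∈A ≈-refl , sym (translate-back x x₀)) ,
      (λ (h , h∈H , x≈) → let (a , a∈A , h≈) = origin h∈H
                           in ∈-resp-≈ setoid (sym (trans x≈ (trans (∙-congˡ h≈) (translate-back a x₀)))) a∈A)

lemma5 : {c ℓ : Level} (G : AbelianGroup c ℓ) (A : List (AbelianGroup.Carrier G)) →
    IsFinSubset G A → 3 ≤ length A →
    ((∃[ k ] (k < length A × CardLe G (Wedge2 G A) k)) ⇔ Is2Coset G A)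
lemma5 G [] _ ()
lemma5 G A@(_ ∷ _) u 3≤|A| =
  mk⇔ (2affine⇒coset u ∘ small-wedge⇒2affine A u 3≤|A|)
      (2affine⇒small-wedge ∘ coset⇒2affine)
  where open Theory G
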